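{- For every $n\ge 2$, the binary reflected Gray code $\Gamma_n$ is a Hamilton cycle of the hypercube $Q_n$ with compression factor $\kappa(Q_n,\Gamma_n)=4$.
   Context: $Q_n$ has as vertices all bitstrings of length $n$, adjacent iff they differ in exactly one bit. The binary reflected Gray code is the cyclic sequence of bitstrings defined by $\Gamma_0:=\varepsilon$ (the sequence consisting of the empty string) and $\Gamma_n:=0\Gamma_{n-1},1\overleftarrow{\Gamma_{n-1}}$ for $n\ge1$, where $0\Gamma_{n-1}$ prefixes every string of $\Gamma_{n-1}$ by $0$, and $1\overleftarrow{\Gamma_{n-1}}$ prefixes by $1$ every string of the reversed sequence $\overleftarrow{\Gamma_{n-1}}$. For a graph $G$ with $N$ vertices, a Hamilton cycle $C=(x_1,\ldots,x_N)$ is $k$-symmetric (for a positive integer $k$ dividing $N$) if the map $x_i\mapsto x_{i+N/k}$ (indices modulo $N$) is an automorphism of $G$; the compression factor $\kappa(G,C)$ is the largest such $k$. -}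

module Defs where

open import Data.Bool using (Bool; true; false; _≟_)
open import Data.Nat using (ℕ; zero; suc; _+_; _*_; _≤_)
open import Data.Vec using (Vec; []; _∷_)
open import Data.List using (List; []; _∷_; map; _++_; reverse; length; drop; take; [_])
open import Data.List.Relation.Unary.Unique.Propositional using (Unique)
open import Data.List.Relation.Unary.Linked using (Linked)
open import Data.List.Membership.Propositional using (_∈_)
open import Data.Product using (Σ; _×_)
open import Relation.Binary.PropositionalEquality using (_≡_)
open import Relation.Nullary using (does)
open import Data.Empty using (⊥)
open import Function.Definitions using (Bijective)
open import Function.Bundles using (_⇔_)

-- vertices of Q_n: bitstrings of length n (false = 0, true = 1)
Bits : ℕ → Set
Bits n = Vec Bool n

diffCount : ∀ {n} → Bits n → Bits n → ℕ
diffCount [] [] = 0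
diffCount (b ∷ xs) (c ∷ ys) with does (b ≟ c)
... | true  = diffCount xs ys
... | false = suc (diffCount xs ys)

Adj : ∀ {n} → Bits n → Bits n → Set
Adj x y = diffCount x y ≡ 1

Γ : (n : ℕ) → List (Bits n)
Γ zero    = [] ∷ []
Γ (suc n) = map (false ∷_) (Γ n) ++ map (true ∷_) (reverse (Γ n))

CyclicallyAdjacent : ∀ {n} → List (Bits n) → Set
CyclicallyAdjacent []       = ⊥
CyclicallyAdjacent (x ∷ xs) = Linked Adj ((x ∷ xs) ++ [ x ])

IsHamiltonCycle : ∀ n → List (Bits n) → Set
IsHamiltonCycle n C =
  3 ≤ length C × Unique C × (∀ (v : Bits n) → v ∈ C) × CyclicallyAdjacent C

IsAutomorphism : ∀ n → (Bits n → Bits n) → Set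
IsAutomorphism n f =
  Bijective _≡_ _≡_ f × (∀ (x y : Bits n) → Adj x y ⇔ Adj (f x) (f y))

-- C is k-symmetric: k positive, k ∣ N (N = q * k, q = N/k), and the map
-- x_i ↦ x_{i+q} (indices mod N) is an automorphism, i.e. there is an
-- automorphism f with f x_i = x_{i+q} for all i, i.e. map f C is C rotated by q.
IsKSymmetric : ∀ n → List (Bits n) → ℕ → Set
IsKSymmetric n C k =
  1 ≤ k × Σ ℕ (λ q → q * k ≡ length C ×
    Σ (Bits n → Bits n) (λ f → IsAutomorphism n f × map f C ≡ drop q C ++ take q C))

CompressionFactorIs : ∀ n → List (Bits n) → ℕ → Set
CompressionFactorIs n C k = IsKSymmetric n C k × (∀ k' → IsKSymmetric n C k' → k' ≤ k)

{-# OPTIONS --safe #-}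

-- Reversing Γ n is the same as flipping the first bit of every entry (Γ-reverse), so Γ n
-- runs from 0ⁿ to 10ⁿ⁻¹ and the two halves of Γ (suc n) join up; this gives the Hamilton
-- cycle.  The quarters of Γ (2 + n) are 00Γ, 01Γ′, 11Γ, 10Γ′ with Γ′ the first-bit flip of
-- Γ = Γ n, and the isometry ab x ↦ b(¬a) (flipHead x) maps each quarter onto the next, so
-- Γ (2 + n) is 4-symmetric.  Conversely, a shift by q with q · k = 2ⁿ forces q = 2ˢ and
-- k = 2ᵗ.  If k ≥ 8, the entries at positions 0 and 4q − 1 are adjacent, whereas the entries
-- at q and 5q − 1, to which the automorphism must send them, differ in two bits.
module Submission where

open import Defs
open import Data.Bool using (Bool; true; false; not)
open import Data.Bool.Properties using (not-involutive)
open import Data.Nat using (ℕ; zero; suc; _+_; _*_; _∸_; _^_; _≤_; _<_; z≤n; s≤s; _<?_)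
open import Data.Nat.Properties
open import Data.Nat.Divisibility using (divides)
open import Data.Nat.Primality using (prime[2]; euclidsLemma)
open import Data.Nat.Tactic.RingSolver using (solve-∀)
open import Algebra.Properties.CommutativeSemigroup +-commutativeSemigroup using (x∙yz≈y∙xz)
open import Data.Vec using ([]; _∷_; replicate)
import Data.Vec as Vec
open import Data.Vec.Properties using (∷-injectiveʳ)
open import Data.List using (List; []; _∷_; map; _++_; _∷ʳ_; reverse; length; drop; take; head; last)
open import Data.List.Properties
  using ( map-++; map-∘; map-cong; map-id; length-map; length-++; ++-assoc
        ; reverse-++; reverse-map; reverse-involutive; length-reverse; unfold-reverse)
open import Data.List.Relation.Unary.Linked using (Linked; [-]) renaming (map to Linked-map)
import Data.List.Relation.Unary.Linked.Properties as Linked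
open import Data.List.Relation.Unary.Unique.Propositional using (Unique; []; _∷_)
import Data.List.Relation.Unary.Unique.Propositional.Properties as Unique
open import Data.List.Membership.Propositional using (_∈_)
open import Data.List.Membership.Propositional.Properties using (∈-map⁺; ∈-map⁻; ∈-++⁺ˡ; ∈-++⁺ʳ)
open import Data.List.Relation.Unary.Any using (here)
open import Data.List.Relation.Unary.All using ([])
open import Data.Maybe using (Maybe; just; nothing)
import Data.Maybe as Maybe
open import Data.Maybe.Properties using (just-injective)
open import Data.Maybe.Relation.Binary.Connected using (Connected; just)
open import Data.Sum using (inj₁; inj₂)
open import Data.Product using (∃-syntax; _×_; _,_; proj₁; proj₂)
open import Relation.Nullary using (¬_; yes; no; contradiction)
open import Relation.Binary.PropositionalEquality
open import Function using (_∘_)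
open import Function.Bundles using (mk⇔; Equivalence)

open ≡-Reasoning

zeros : ∀ n → Bits n
zeros n = replicate n false

flipHead : ∀ {n} → Bits n → Bits n
flipHead []      = []
flipHead (b ∷ x) = not b ∷ x

flipHead-involutive : ∀ {n} (x : Bits n) → flipHead (flipHead x) ≡ x
flipHead-involutive []          = refl
flipHead-involutive (false ∷ x) = refl
flipHead-involutive (true ∷ x)  = refl

flipHead-injective : ∀ {n} {x y : Bits n} → flipHead x ≡ flipHead y → x ≡ y
flipHead-injective {x = x} {y} eq =
  trans (sym (flipHead-involutive x)) (trans (cong flipHead eq) (flipHead-involutive y))

diffCount-refl : ∀ {n} (x : Bits n) → diffCount x x ≡ 0
diffCount-refl []          = refl
diffCount-refl (false ∷ x) = diffCount-refl x
diffCount-refl (true ∷ x)  = diffCount-refl x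

diffCount-∷ : ∀ {n} a b (x y : Bits n) →
              diffCount (a ∷ x) (b ∷ y) ≡ diffCount (a ∷ []) (b ∷ []) + diffCount x y
diffCount-∷ false false x y = refl
diffCount-∷ false true  x y = refl
diffCount-∷ true  false x y = refl
diffCount-∷ true  true  x y = refl

diffCount-flipHead : ∀ {n} (x y : Bits n) → diffCount (flipHead x) (flipHead y) ≡ diffCount x y
diffCount-flipHead []          []          = refl
diffCount-flipHead (false ∷ x) (false ∷ y) = refl
diffCount-flipHead (false ∷ x) (true ∷ y)  = refl
diffCount-flipHead (true ∷ x)  (false ∷ y) = refl
diffCount-flipHead (true ∷ x)  (true ∷ y)  = refl

diffCount-++ : ∀ {m n} (z : Bits m) (x y : Bits n) → diffCount (z Vec.++ x) (z Vec.++ y) ≡ diffCount x y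
diffCount-++ []          x y = refl
diffCount-++ (false ∷ z) x y = diffCount-++ z x y
diffCount-++ (true ∷ z)  x y = diffCount-++ z x y

Adj-not-∷ : ∀ {n} b (x : Bits n) → Adj (b ∷ x) (not b ∷ x)
Adj-not-∷ false x = cong suc (diffCount-refl x)
Adj-not-∷ true  x = cong suc (diffCount-refl x)

¬Adj-false∷false∷-true∷true∷ : ∀ {n} {x y : Bits n} → ¬ Adj (false ∷ false ∷ x) (true ∷ true ∷ y)
¬Adj-false∷false∷-true∷true∷ ()

isometry⇒automorphism : ∀ {n} (f g : Bits n → Bits n) →
                        (∀ x → f (g x) ≡ x) → (∀ x → g (f x) ≡ x) →
                        (∀ x y → diffCount (f x) (f y) ≡ diffCount x y) → IsAutomorphism n f
isometry⇒automorphism f g f∘g≗id g∘f≗id iso =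
  inverseᵇ⇒bijective (strictlyInverseˡ⇒inverseˡ f f∘g≗id , strictlyInverseʳ⇒inverseʳ f g∘f≗id) ,
  λ x y → mk⇔ (trans (iso x y)) (trans (sym (iso x y)))
  where open import Function.Consequences.Propositional

last-∷ʳ : ∀ {A : Set} (xs : List A) x → last (xs ∷ʳ x) ≡ just x
last-∷ʳ []           x = refl
last-∷ʳ (y ∷ [])     x = refl
last-∷ʳ (y ∷ z ∷ xs) x = last-∷ʳ (z ∷ xs) x

last-map : ∀ {A B : Set} (f : A → B) xs → last (map f xs) ≡ Maybe.map f (last xs)
last-map f []           = refl
last-map f (x ∷ [])     = refl
last-map f (x ∷ y ∷ xs) = last-map f (y ∷ xs)

drop-length-++ : ∀ {A : Set} (xs ys : List A) → drop (length xs) (xs ++ ys) ≡ ys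
drop-length-++ []       ys = refl
drop-length-++ (x ∷ xs) ys = drop-length-++ xs ys

take-length-++ : ∀ {A : Set} (xs ys : List A) → take (length xs) (xs ++ ys) ≡ xs
take-length-++ []       ys = refl
take-length-++ (x ∷ xs) ys = cong (x ∷_) (take-length-++ xs ys)

map-rotates-four-blocks : ∀ {A : Set} (f : A → A) (as bs cs ds : List A) →
  map f as ≡ bs → map f bs ≡ cs → map f cs ≡ ds → map f ds ≡ as →
  let xs = as ++ bs ++ cs ++ ds in map f xs ≡ drop (length as) xs ++ take (length as) xs
map-rotates-four-blocks f as bs cs ds fa fb fc fd = begin
  map f (as ++ bs ++ cs ++ ds)
    ≡⟨ map-++ f as _ ⟩
  map f as ++ map f (bs ++ cs ++ ds)
    ≡⟨ cong (map f as ++_) (trans (map-++ f bs _) (cong (map f bs ++_) (map-++ f cs ds))) ⟩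
  map f as ++ map f bs ++ map f cs ++ map f ds
    ≡⟨ cong₂ _++_ fa (cong₂ _++_ fb (cong₂ _++_ fc fd)) ⟩
  bs ++ cs ++ ds ++ as
    ≡⟨ trans (++-assoc bs (cs ++ ds) as) (cong (bs ++_) (++-assoc cs ds as)) ⟨
  (bs ++ cs ++ ds) ++ as
    ≡⟨ cong₂ _++_ (drop-length-++ as _) (take-length-++ as _) ⟨
  drop (length as) (as ++ bs ++ cs ++ ds) ++ take (length as) (as ++ bs ++ cs ++ ds) ∎

infixl 5 _‼_
_‼_ : ∀ {A : Set} → List A → ℕ → Maybe A
[]       ‼ _     = nothing
(x ∷ xs) ‼ zero  = just x
(x ∷ xs) ‼ suc i = xs ‼ i

‼-map : ∀ {A B : Set} (f : A → B) xs i → map f xs ‼ i ≡ Maybe.map f (xs ‼ i)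
‼-map f []       i       = refl
‼-map f (x ∷ xs) zero    = refl
‼-map f (x ∷ xs) (suc i) = ‼-map f xs i

‼-++ˡ : ∀ {A : Set} (xs ys : List A) {i} → i < length xs → (xs ++ ys) ‼ i ≡ xs ‼ i
‼-++ˡ (x ∷ xs) ys {zero}  _         = refl
‼-++ˡ (x ∷ xs) ys {suc i} (s≤s i<n) = ‼-++ˡ xs ys i<n

‼-++ʳ : ∀ {A : Set} (xs ys : List A) i → (xs ++ ys) ‼ (length xs + i) ≡ ys ‼ i
‼-++ʳ []       ys i = refl
‼-++ʳ (x ∷ xs) ys i = ‼-++ʳ xs ys i

‼-drop-++ : ∀ {A : Set} (xs ys : List A) q {i} → q + i < length xs → (drop q xs ++ ys) ‼ i ≡ xs ‼ (q + i)
‼-drop-++ xs       ys zero    i<n       = ‼-++ˡ xs ys i<n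
‼-drop-++ (x ∷ xs) ys (suc q) (s≤s q+i<n) = ‼-drop-++ xs ys q q+i<n

map-flipHead-involutive : ∀ {n} (xs : List (Bits n)) → map flipHead (map flipHead xs) ≡ xs
map-flipHead-involutive xs =
  trans (sym (map-∘ xs)) (trans (map-cong flipHead-involutive xs) (map-id xs))

map-flipHead-∷ : ∀ {n} b (xs : List (Bits n)) → map flipHead (map (b ∷_) xs) ≡ map (not b ∷_) xs
map-flipHead-∷ b xs = sym (map-∘ xs)

Γ-reverse : ∀ n → reverse (Γ n) ≡ map flipHead (Γ n)
Γ-reverse zero    = refl
Γ-reverse (suc n) = begin
  reverse (map (false ∷_) (Γ n) ++ map (true ∷_) (reverse (Γ n)))
    ≡⟨ reverse-++ (map (false ∷_) (Γ n)) _ ⟩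
  reverse (map (true ∷_) (reverse (Γ n))) ++ reverse (map (false ∷_) (Γ n))
    ≡⟨ cong₂ _++_ (sym (reverse-map _ (reverse (Γ n)))) (sym (reverse-map _ (Γ n))) ⟩
  map (true ∷_) (reverse (reverse (Γ n))) ++ map (false ∷_) (reverse (Γ n))
    ≡⟨ cong (λ xs → map (true ∷_) xs ++ map (false ∷_) (reverse (Γ n))) (reverse-involutive (Γ n)) ⟩
  map (flipHead ∘ (false ∷_)) (Γ n) ++ map (flipHead ∘ (true ∷_)) (reverse (Γ n))
    ≡⟨ cong₂ _++_ (map-∘ (Γ n)) (map-∘ (reverse (Γ n))) ⟩
  map flipHead (map (false ∷_) (Γ n)) ++ map flipHead (map (true ∷_) (reverse (Γ n)))
    ≡⟨ map-++ flipHead (map (false ∷_) (Γ n)) _ ⟨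
  map flipHead (Γ (suc n)) ∎

Γ-suc : ∀ n → Γ (suc n) ≡ map (false ∷_) (Γ n) ++ map (true ∷_) (map flipHead (Γ n))
Γ-suc n = cong (λ xs → map (false ∷_) (Γ n) ++ map (true ∷_) xs) (Γ-reverse n)

length-Γ : ∀ n → length (Γ n) ≡ 2 ^ n
length-Γ zero    = refl
length-Γ (suc n) = begin
  length (map (false ∷_) (Γ n) ++ map (true ∷_) (reverse (Γ n)))
    ≡⟨ length-++ (map (false ∷_) (Γ n)) ⟩
  length (map (false ∷_) (Γ n)) + length (map (true ∷_) (reverse (Γ n)))
    ≡⟨ cong₂ _+_ (length-map _ (Γ n)) (trans (length-map _ (reverse (Γ n))) (length-reverse (Γ n))) ⟩
  length (Γ n) + length (Γ n)
    ≡⟨ cong₂ _+_ (length-Γ n) (trans (length-Γ n) (sym (+-identityʳ (2 ^ n)))) ⟩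
  2 ^ suc n ∎

length-map-Γ : ∀ m (f : Bits m → Bits (suc m)) → length (map f (Γ m)) ≡ 2 ^ m
length-map-Γ m f = trans (length-map f (Γ m)) (length-Γ m)

∈-Γ : ∀ {n} (v : Bits n) → v ∈ Γ n
∈-Γ []                  = here refl
∈-Γ {suc n} (false ∷ v) = subst (false ∷ v ∈_) (sym (Γ-suc n)) (∈-++⁺ˡ (∈-map⁺ (false ∷_) (∈-Γ v)))
∈-Γ {suc n} (true ∷ v)  = subst (true ∷ v ∈_) (sym (Γ-suc n)) (∈-++⁺ʳ _ (∈-map⁺ (true ∷_) v∈flipped))
  where
  v∈flipped : v ∈ map flipHead (Γ n)
  v∈flipped = subst (_∈ _) (flipHead-involutive v) (∈-map⁺ flipHead (∈-Γ (flipHead v)))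

Γ-unique : ∀ n → Unique (Γ n)
Γ-unique zero    = [] ∷ []
Γ-unique (suc n) = subst Unique (sym (Γ-suc n))
  (Unique.++⁺ (Unique.map⁺ ∷-injectiveʳ (Γ-unique n))
              (Unique.map⁺ ∷-injectiveʳ (Unique.map⁺ flipHead-injective (Γ-unique n)))
              first-bits-differ)
  where
  first-bits-differ : ∀ {v} → ¬ (v ∈ map (false ∷_) (Γ n) × v ∈ map (true ∷_) (map flipHead (Γ n)))
  first-bits-differ (p , q) with ∈-map⁻ (false ∷_) p | ∈-map⁻ (true ∷_) q
  ... | _ , _ , refl | _ , _ , ()

Γ-head : ∀ n → ∃[ xs ] Γ n ≡ zeros n ∷ xs
Γ-head zero    = [] , refl
Γ-head (suc n) with Γ-head n
... | xs , eq = _ , cong (λ ys → map (false ∷_) ys ++ map (true ∷_) (reverse (Γ n))) eq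

Γ-last : ∀ n → ∃[ xs ] Γ n ≡ xs ∷ʳ flipHead (zeros n)
Γ-last n with Γ-head n
... | xs , eq = reverse (map flipHead xs) , (begin
  Γ n                                             ≡⟨ reverse-involutive (Γ n) ⟨
  reverse (reverse (Γ n))                         ≡⟨ cong reverse (Γ-reverse n) ⟩
  reverse (map flipHead (Γ n))                    ≡⟨ cong (reverse ∘ map flipHead) eq ⟩
  reverse (map flipHead (zeros n ∷ xs))           ≡⟨ unfold-reverse _ (map flipHead xs) ⟩
  reverse (map flipHead xs) ∷ʳ flipHead (zeros n) ∎)

last-Γ : ∀ n → last (Γ n) ≡ just (flipHead (zeros n))
last-Γ n = trans (cong last (proj₂ (Γ-last n))) (last-∷ʳ (proj₁ (Γ-last n)) _)

Γ-linked : ∀ n → Linked Adj (Γ n)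
Γ-linked zero    = [-]
Γ-linked (suc n) = subst (Linked Adj) (sym (Γ-suc n))
  (Linked.++⁺ (Linked.map⁺ (Γ-linked n)) junction (Linked.map⁺ (Linked.map⁺ flipped)))
  where
  flipped : Linked (λ x y → Adj (flipHead x) (flipHead y)) (Γ n)
  flipped = Linked-map (λ {x} {y} → trans (diffCount-flipHead x y)) (Γ-linked n)
  junction : Connected Adj (last (map (false ∷_) (Γ n))) (head (map (true ∷_) (map flipHead (Γ n))))
  junction = subst₂ (Connected Adj) (sym last-lower) (sym head-upper)
                    (just (Adj-not-∷ false (flipHead (zeros n))))
    where
    last-lower : last (map (false ∷_) (Γ n)) ≡ just (false ∷ flipHead (zeros n))
    last-lower = trans (last-map _ (Γ n)) (cong (Maybe.map _) (last-Γ n))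
    head-upper : head (map (true ∷_) (map flipHead (Γ n))) ≡ just (true ∷ flipHead (zeros n))
    head-upper = cong (head ∘ map (true ∷_) ∘ map flipHead) (proj₂ (Γ-head n))

Γ-cyclic : ∀ n → CyclicallyAdjacent (Γ (suc n))
Γ-cyclic n with Γ-head (suc n)
... | xs , eq = subst CyclicallyAdjacent (sym eq)
  (subst (λ C → Linked Adj (C ∷ʳ zeros (suc n))) eq (Linked.++⁺ (Γ-linked (suc n)) closing [-]))
  where
  closing : Connected Adj (last (Γ (suc n))) (just (zeros (suc n)))
  closing = subst (λ x → Connected Adj x (just (zeros (suc n)))) (sym (last-Γ (suc n)))
                  (just (Adj-not-∷ true (zeros n)))

quarterShift : ∀ {n} → Bits (2 + n) → Bits (2 + n)
quarterShift (a ∷ b ∷ x) = b ∷ not a ∷ flipHead x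

quarterShift⁻¹ : ∀ {n} → Bits (2 + n) → Bits (2 + n)
quarterShift⁻¹ (a ∷ b ∷ x) = not b ∷ a ∷ flipHead x

diffCount-quarterShift : ∀ {n} (x y : Bits (2 + n)) →
                         diffCount (quarterShift x) (quarterShift y) ≡ diffCount x y
diffCount-quarterShift (a ∷ b ∷ x) (c ∷ d ∷ y) = begin
  diffCount (b ∷ not a ∷ flipHead x) (d ∷ not c ∷ flipHead y)
    ≡⟨ diffCount-∷ b d _ _ ⟩
  δ b d + diffCount (not a ∷ flipHead x) (not c ∷ flipHead y)
    ≡⟨ cong (δ b d +_) (diffCount-flipHead (a ∷ flipHead x) (c ∷ flipHead y)) ⟩
  δ b d + diffCount (a ∷ flipHead x) (c ∷ flipHead y)
    ≡⟨ cong (δ b d +_) (diffCount-∷ a c _ _) ⟩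
  δ b d + (δ a c + diffCount (flipHead x) (flipHead y))
    ≡⟨ cong (λ k → δ b d + (δ a c + k)) (diffCount-flipHead x y) ⟩
  δ b d + (δ a c + diffCount x y)
    ≡⟨ x∙yz≈y∙xz (δ b d) (δ a c) _ ⟩
  δ a c + (δ b d + diffCount x y)
    ≡⟨ cong (δ a c +_) (diffCount-∷ b d x y) ⟨
  δ a c + diffCount (b ∷ x) (d ∷ y)
    ≡⟨ diffCount-∷ a c _ _ ⟨
  diffCount (a ∷ b ∷ x) (c ∷ d ∷ y) ∎
  where
  δ : Bool → Bool → ℕ
  δ a b = diffCount (a ∷ []) (b ∷ [])

quarterShift-automorphism : ∀ n → IsAutomorphism (2 + n) quarterShift
quarterShift-automorphism n =
  isometry⇒automorphism quarterShift quarterShift⁻¹ shift∘unshift unshift∘shift diffCount-quarterShift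
  where
  shift∘unshift : ∀ (x : Bits (2 + n)) → quarterShift (quarterShift⁻¹ x) ≡ x
  shift∘unshift (a ∷ b ∷ x) = cong₂ (λ c y → a ∷ c ∷ y) (not-involutive b) (flipHead-involutive x)
  unshift∘shift : ∀ (x : Bits (2 + n)) → quarterShift⁻¹ (quarterShift x) ≡ x
  unshift∘shift (a ∷ b ∷ x) = cong₂ (λ c y → c ∷ b ∷ y) (not-involutive a) (flipHead-involutive x)

map-quarterShift : ∀ {n} a b (xs : List (Bits n)) →
                   map quarterShift (map (a ∷_) (map (b ∷_) xs)) ≡ map (b ∷_) (map (not a ∷_) (map flipHead xs))
map-quarterShift a b []       = refl
map-quarterShift a b (x ∷ xs) = cong (_ ∷_) (map-quarterShift a b xs)

Γ-quarters : ∀ n → Γ (2 + n) ≡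
  map (false ∷_) (map (false ∷_) (Γ n)) ++ map (false ∷_) (map (true ∷_) (map flipHead (Γ n))) ++
  map (true ∷_) (map (true ∷_) (Γ n)) ++ map (true ∷_) (map (false ∷_) (map flipHead (Γ n)))
Γ-quarters n = begin
  Γ (2 + n)
    ≡⟨ Γ-suc (suc n) ⟩
  map (false ∷_) (Γ (suc n)) ++ map (true ∷_) (map flipHead (Γ (suc n)))
    ≡⟨ cong (λ xs → map (false ∷_) xs ++ map (true ∷_) (map flipHead xs)) (Γ-suc n) ⟩
  map (false ∷_) (low ++ high) ++ map (true ∷_) (map flipHead (low ++ high))
    ≡⟨ cong₂ _++_ (map-++ _ low high)
                  (trans (cong (map _) (map-++ flipHead low high)) (map-++ _ (map flipHead low) _)) ⟩
  (map (false ∷_) low ++ map (false ∷_) high) ++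
  (map (true ∷_) (map flipHead low) ++ map (true ∷_) (map flipHead high))
    ≡⟨ ++-assoc (map (false ∷_) low) _ _ ⟩
  map (false ∷_) low ++ map (false ∷_) high ++
  map (true ∷_) (map flipHead low) ++ map (true ∷_) (map flipHead high)
    ≡⟨ cong (λ xs → map (false ∷_) low ++ map (false ∷_) high ++ xs)
            (cong₂ _++_ (cong (map _) (map-flipHead-∷ false (Γ n))) (cong (map _) (map-flipHead-∷ true _))) ⟩
  _ ∎
  where
  low  = map (false ∷_) (Γ n)
  high = map (true ∷_) (map flipHead (Γ n))

Γ-4-symmetric : ∀ n → IsKSymmetric (2 + n) (Γ (2 + n)) 4
Γ-4-symmetric n = s≤s z≤n , length A , quarter-length , quarterShift , quarterShift-automorphism n , rotation
  where
  A B C D : List (Bits (2 + n))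
  A = map (false ∷_) (map (false ∷_) (Γ n))
  B = map (false ∷_) (map (true ∷_) (map flipHead (Γ n)))
  C = map (true ∷_) (map (true ∷_) (Γ n))
  D = map (true ∷_) (map (false ∷_) (map flipHead (Γ n)))
  length-A : length A ≡ 2 ^ n
  length-A = trans (length-map (false ∷_) (map (false ∷_) (Γ n))) (length-map-Γ n (false ∷_))
  quarter-length : length A * 4 ≡ length (Γ (2 + n))
  quarter-length = begin
    length A * 4       ≡⟨ cong (_* 4) length-A ⟩
    2 ^ n * 4          ≡⟨ *-comm (2 ^ n) 4 ⟩
    4 * 2 ^ n          ≡⟨ *-assoc 2 2 (2 ^ n) ⟩
    2 ^ (2 + n)        ≡⟨ length-Γ (2 + n) ⟨
    length (Γ (2 + n)) ∎
  rotation : map quarterShift (Γ (2 + n)) ≡ drop (length A) (Γ (2 + n)) ++ take (length A) (Γ (2 + n))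
  rotation = subst (λ xs → map quarterShift xs ≡ drop (length A) xs ++ take (length A) xs) (sym (Γ-quarters n))
    (map-rotates-four-blocks quarterShift A B C D
      (map-quarterShift false false (Γ n))
      (trans (map-quarterShift false true _)
             (cong (map (true ∷_) ∘ map (true ∷_)) (map-flipHead-involutive (Γ n))))
      (map-quarterShift true true (Γ n))
      (trans (map-quarterShift true false _)
             (cong (map (false ∷_) ∘ map (false ∷_)) (map-flipHead-involutive (Γ n)))))

-- The entry of Γ n at position i (Γ-‼); meaningless for i ≥ 2 ^ n.
gray : (n : ℕ) → ℕ → Bits n
gray zero    i = []
gray (suc n) i with i <? 2 ^ n
... | yes _ = false ∷ gray n i
... | no  _ = true ∷ flipHead (gray n (i ∸ 2 ^ n))

gray-< : ∀ n {i} → i < 2 ^ n → gray (suc n) i ≡ false ∷ gray n i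
gray-< n {i} i<2^n with i <? 2 ^ n
... | yes _     = refl
... | no  i≮2^n = contradiction i<2^n i≮2^n

gray-2^+ : ∀ n j → gray (suc n) (2 ^ n + j) ≡ true ∷ flipHead (gray n j)
gray-2^+ n j with 2 ^ n + j <? 2 ^ n
... | yes 2^n+j<2^n = contradiction 2^n+j<2^n (m+n≮m (2 ^ n) j)
... | no  _         = cong (λ k → true ∷ flipHead (gray n k)) (m+n∸m≡n (2 ^ n) j)

Γ-‼ : ∀ n {i} → i < 2 ^ n → Γ n ‼ i ≡ just (gray n i)
Γ-‼ zero    {zero}  _         = refl
Γ-‼ zero    {suc i} (s≤s ())
Γ-‼ (suc n) {i} i<2^[1+n] with <-≤-connex i (2 ^ n)
... | inj₁ i<2^n = begin
  Γ (suc n) ‼ i                  ≡⟨ cong (_‼ i) (Γ-suc n) ⟩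
  (low ++ high) ‼ i              ≡⟨ ‼-++ˡ low high (subst (i <_) (sym (length-map-Γ n (false ∷_))) i<2^n) ⟩
  low ‼ i                        ≡⟨ ‼-map (false ∷_) (Γ n) i ⟩
  Maybe.map (false ∷_) (Γ n ‼ i) ≡⟨ cong (Maybe.map (false ∷_)) (Γ-‼ n i<2^n) ⟩
  just (false ∷ gray n i)        ≡⟨ cong just (gray-< n i<2^n) ⟨
  just (gray (suc n) i)          ∎
  where
  low high : List (Bits (suc n))
  low  = map (false ∷_) (Γ n)
  high = map (true ∷_) (map flipHead (Γ n))
... | inj₂ 2^n≤i with m≤n⇒∃[o]m+o≡n 2^n≤i
...   | j , refl = begin
  Γ (suc n) ‼ (2 ^ n + j)
    ≡⟨ cong₂ _‼_ (Γ-suc n) (cong (_+ j) (sym (length-map-Γ n (false ∷_)))) ⟩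
  (low ++ high) ‼ (length low + j)
    ≡⟨ ‼-++ʳ low high j ⟩
  high ‼ j
    ≡⟨ ‼-map (true ∷_) (map flipHead (Γ n)) j ⟩
  Maybe.map (true ∷_) (map flipHead (Γ n) ‼ j)
    ≡⟨ cong (Maybe.map (true ∷_)) (‼-map flipHead (Γ n) j) ⟩
  Maybe.map (true ∷_) (Maybe.map flipHead (Γ n ‼ j))
    ≡⟨ cong (Maybe.map (true ∷_) ∘ Maybe.map flipHead) (Γ-‼ n j<2^n) ⟩
  just (true ∷ flipHead (gray n j))
    ≡⟨ cong just (gray-2^+ n j) ⟨
  just (gray (suc n) (2 ^ n + j)) ∎
  where
  low high : List (Bits (suc n))
  low  = map (false ∷_) (Γ n)
  high = map (true ∷_) (map flipHead (Γ n))
  j<2^n : j < 2 ^ n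
  j<2^n = subst (j <_) (+-identityʳ (2 ^ n)) (+-cancelˡ-< (2 ^ n) j (2 ^ n + 0) i<2^[1+n])

gray-zero : ∀ n → gray n 0 ≡ zeros n
gray-zero zero    = refl
gray-zero (suc n) = trans (gray-< n (m^n>0 2 n)) (cong (false ∷_) (gray-zero n))

gray-last : ∀ n {p} → suc p ≡ 2 ^ n → gray n p ≡ flipHead (zeros n)
gray-last n {p} 1+p≡2^n with Γ-last n
... | xs , Γ≡xs∷ʳlast = just-injective (begin
  just (gray n p)                              ≡⟨ Γ-‼ n (≤-reflexive 1+p≡2^n) ⟨
  Γ n ‼ p                                      ≡⟨ cong₂ _‼_ Γ≡xs∷ʳlast (trans p≡length-xs (sym (+-identityʳ _))) ⟩
  (xs ∷ʳ flipHead (zeros n)) ‼ (length xs + 0) ≡⟨ ‼-++ʳ xs _ 0 ⟩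
  just (flipHead (zeros n))                    ∎)
  where
  p≡length-xs : p ≡ length xs
  p≡length-xs = suc-injective (begin
    suc p                ≡⟨ 1+p≡2^n ⟩
    2 ^ n                ≡⟨ length-Γ n ⟨
    length (Γ n)         ≡⟨ cong length Γ≡xs∷ʳlast ⟩
    length (xs ∷ʳ flipHead (zeros n)) ≡⟨ length-++ xs ⟩
    length xs + 1        ≡⟨ +-comm (length xs) 1 ⟩
    suc (length xs)      ∎)

gray-padding : ∀ r {m i} → i < 2 ^ m → gray (r + m) i ≡ zeros r Vec.++ gray m i
gray-padding zero        _      = refl
gray-padding (suc r) {m} i<2^m =
  trans (gray-< (r + m) (<-≤-trans i<2^m (^-monoʳ-≤ 2 (m≤n+m m r)))) (cong (false ∷_) (gray-padding r i<2^m))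

diffCount-gray-padding : ∀ r {m i j} → i < 2 ^ m → j < 2 ^ m →
                         diffCount (gray (r + m) i) (gray (r + m) j) ≡ diffCount (gray m i) (gray m j)
diffCount-gray-padding r i<2^m j<2^m =
  trans (cong₂ diffCount (gray-padding r i<2^m) (gray-padding r j<2^m)) (diffCount-++ (zeros r) _ _)

rotation⇒gray-shift : ∀ {n} {f : Bits n → Bits n} q → map f (Γ n) ≡ drop q (Γ n) ++ take q (Γ n) →
                      ∀ {i} → q + i < 2 ^ n → f (gray n i) ≡ gray n (q + i)
rotation⇒gray-shift {n} {f} q rotation {i} q+i<2^n = just-injective (begin
  just (f (gray n i))                ≡⟨ cong (Maybe.map f) (Γ-‼ n (≤-<-trans (m≤n+m i q) q+i<2^n)) ⟨
  Maybe.map f (Γ n ‼ i)              ≡⟨ ‼-map f (Γ n) i ⟨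
  map f (Γ n) ‼ i                    ≡⟨ cong (_‼ i) rotation ⟩
  (drop q (Γ n) ++ take q (Γ n)) ‼ i ≡⟨ ‼-drop-++ (Γ n) _ q (subst (q + i <_) (sym (length-Γ n)) q+i<2^n) ⟩
  Γ n ‼ (q + i)                      ≡⟨ Γ-‼ n q+i<2^n ⟩
  just (gray n (q + i))              ∎)

Adj-gray-0-end-of-lower-half : ∀ m {b} → suc b ≡ 2 ^ suc m → Adj (gray (2 + m) 0) (gray (2 + m) b)
Adj-gray-0-end-of-lower-half m {b} 1+b≡2^[1+m] =
  subst₂ Adj (sym (gray-zero (2 + m))) (sym gray-b) (Adj-not-∷ false (zeros m))
  where
  gray-b : gray (2 + m) b ≡ false ∷ flipHead (zeros (suc m))
  gray-b = trans (gray-< (suc m) (≤-reflexive 1+b≡2^[1+m])) (cong (false ∷_) (gray-last (suc m) 1+b≡2^[1+m]))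

¬Adj-gray-first-third-quarter : ∀ m {i j} → i < 2 ^ m → j < 2 ^ m →
                                ¬ Adj (gray (2 + m) i) (gray (2 + m) (2 ^ suc m + j))
¬Adj-gray-first-third-quarter m {i} {j} i<2^m j<2^m =
  ¬Adj-false∷false∷-true∷true∷ {x = gray m i} {gray m j} ∘ subst₂ Adj first-quarter third-quarter
  where
  first-quarter : gray (2 + m) i ≡ false ∷ false ∷ gray m i
  first-quarter = trans (gray-< (suc m) (<-≤-trans i<2^m (^-monoʳ-≤ 2 (n≤1+n m))))
                        (cong (false ∷_) (gray-< m i<2^m))
  third-quarter : gray (2 + m) (2 ^ suc m + j) ≡ true ∷ true ∷ gray m j
  third-quarter = trans (gray-2^+ (suc m) j) (cong (λ x → true ∷ flipHead x) (gray-< m j<2^m))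

2^-factors : ∀ n q k → q * k ≡ 2 ^ n → ∃[ s ] ∃[ t ] (q ≡ 2 ^ s × k ≡ 2 ^ t × s + t ≡ n)
2^-factors zero q k qk≡1 = 0 , 0 , m*n≡1⇒m≡1 q k qk≡1 , m*n≡1⇒n≡1 q k qk≡1 , refl
2^-factors (suc n) q k qk≡2^[1+n]
  with euclidsLemma q k prime[2] (divides (2 ^ n) (trans qk≡2^[1+n] (*-comm 2 (2 ^ n))))
... | inj₁ (divides q′ refl) with 2^-factors n q′ k (*-cancelʳ-≡ (q′ * k) (2 ^ n) 2 (begin
      q′ * k * 2   ≡⟨ *-assoc q′ k 2 ⟩
      q′ * (k * 2) ≡⟨ cong (q′ *_) (*-comm k 2) ⟩
      q′ * (2 * k) ≡⟨ *-assoc q′ 2 k ⟨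
      q′ * 2 * k   ≡⟨ qk≡2^[1+n] ⟩
      2 * 2 ^ n    ≡⟨ *-comm 2 (2 ^ n) ⟩
      2 ^ n * 2    ∎))
...   | s , t , refl , k≡2^t , s+t≡n = suc s , t , *-comm (2 ^ s) 2 , k≡2^t , cong suc s+t≡n
2^-factors (suc n) q k qk≡2^[1+n]
    | inj₂ (divides k′ refl) with 2^-factors n q k′ (*-cancelʳ-≡ (q * k′) (2 ^ n) 2 (begin
      q * k′ * 2   ≡⟨ *-assoc q k′ 2 ⟩
      q * (k′ * 2) ≡⟨ qk≡2^[1+n] ⟩
      2 * 2 ^ n    ≡⟨ *-comm 2 (2 ^ n) ⟩
      2 ^ n * 2    ∎))
...   | s , t , q≡2^s , refl , s+t≡n = s , suc t , q≡2^s , *-comm (2 ^ t) 2 , trans (+-suc s t) (cong suc s+t≡n)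

module EighthPositions {Q p : ℕ} (1+p≡Q : suc p ≡ Q) where

  private
    3x+x≡4x : ∀ x → 3 * x + x ≡ 2 * (2 * x)
    3x+x≡4x = solve-∀
    x+[3x+y]≡4x+y : ∀ x y → x + (3 * x + y) ≡ 2 * (2 * x) + y
    x+[3x+y]≡4x+y = solve-∀
    x+4x+3x≡8x : ∀ x → x + 2 * (2 * x) + 3 * x ≡ 2 * (2 * (2 * x))
    x+4x+3x≡8x = solve-∀

  b : ℕ
  b = 3 * Q + p

  1+b≡4Q : suc b ≡ 2 * (2 * Q)
  1+b≡4Q = begin
    suc (3 * Q + p) ≡⟨ +-suc (3 * Q) p ⟨
    3 * Q + suc p   ≡⟨ cong (3 * Q +_) 1+p≡Q ⟩
    3 * Q + Q       ≡⟨ 3x+x≡4x Q ⟩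
    2 * (2 * Q)     ∎

  Q<2Q : Q < 2 * Q
  Q<2Q = subst (suc Q ≤_) (begin
    suc Q + p ≡⟨ +-suc Q p ⟨
    Q + suc p ≡⟨ cong (Q +_) 1+p≡Q ⟩
    Q + Q     ≡⟨ cong (Q +_) (+-identityʳ Q) ⟨
    2 * Q     ∎) (m≤m+n (suc Q) p)

  p<2Q : p < 2 * Q
  p<2Q = subst (suc p ≤_) (trans (cong (_+ Q) 1+p≡Q) (cong (Q +_) (sym (+-identityʳ Q)))) (m≤m+n (suc p) Q)

  Q+b≡4Q+p : Q + b ≡ 2 * (2 * Q) + p
  Q+b≡4Q+p = x+[3x+y]≡4x+y Q p

  Q+b<8Q : Q + b < 2 * (2 * (2 * Q))
  Q+b<8Q = subst (suc (Q + b) ≤_) (begin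
    suc (Q + b) + 3 * Q     ≡⟨ cong (_+ 3 * Q) (+-suc Q b) ⟨
    Q + suc b + 3 * Q       ≡⟨ cong (λ x → Q + x + 3 * Q) 1+b≡4Q ⟩
    Q + 2 * (2 * Q) + 3 * Q ≡⟨ x+4x+3x≡8x Q ⟩
    2 * (2 * (2 * Q))       ∎) (m≤m+n (suc (Q + b)) (3 * Q))

¬rotation-by-eighth : ∀ {n} r s → n ≡ r + (3 + s) → (f : Bits n → Bits n) → IsAutomorphism n f →
                      ¬ map f (Γ n) ≡ drop (2 ^ s) (Γ n) ++ take (2 ^ s) (Γ n)
¬rotation-by-eighth r s refl f (_ , f-preserves-Adj) rotation =
  ¬Adj-gray-first-third-quarter (suc s) Q<2Q p<2Q
    (subst (λ i → Adj (gray (3 + s) Q) (gray (3 + s) i)) Q+b≡4Q+p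
      (trans (sym (padding Q<8Q Q+b<8Q)) images-adjacent))
  where
  Q = 2 ^ s
  p = Q ∸ 1
  open EighthPositions (m+[n∸m]≡n (m^n>0 2 s))
  8Q≤2^n : 2 ^ (3 + s) ≤ 2 ^ (r + (3 + s))
  8Q≤2^n = ^-monoʳ-≤ 2 (m≤n+m (3 + s) r)
  padding : ∀ {i j} → i < 2 ^ (3 + s) → j < 2 ^ (3 + s) →
            diffCount (gray (r + (3 + s)) i) (gray (r + (3 + s)) j) ≡ diffCount (gray (3 + s) i) (gray (3 + s) j)
  padding = diffCount-gray-padding r
  b<8Q : b < 2 ^ (3 + s)
  b<8Q = ≤-<-trans (m≤n+m b Q) Q+b<8Q
  Q<8Q : Q < 2 ^ (3 + s)
  Q<8Q = ≤-<-trans (m≤m+n Q b) Q+b<8Q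
  preimages-adjacent : Adj (gray (r + (3 + s)) 0) (gray (r + (3 + s)) b)
  preimages-adjacent = trans (padding (≤-<-trans z≤n Q<8Q) b<8Q) (Adj-gray-0-end-of-lower-half (suc s) 1+b≡4Q)
  images-adjacent : Adj (gray (r + (3 + s)) Q) (gray (r + (3 + s)) (Q + b))
  images-adjacent = subst₂ Adj
    (trans (rotation⇒gray-shift Q rotation (<-≤-trans (≤-<-trans (+-monoʳ-≤ Q z≤n) Q+b<8Q) 8Q≤2^n))
           (cong (gray _) (+-identityʳ Q)))
    (rotation⇒gray-shift Q rotation (<-≤-trans Q+b<8Q 8Q≤2^n))
    (Equivalence.to (f-preserves-Adj _ _) preimages-adjacent)

Γ-symmetry≤4 : ∀ n k → IsKSymmetric n (Γ n) k → k ≤ 4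
Γ-symmetry≤4 n k (_ , q , qk≡length , f , f-automorphism , rotation)
  with 2^-factors n q k (trans qk≡length (length-Γ n))
... | _ , 0 , _    , refl , _     = s≤s z≤n
... | _ , 1 , _    , refl , _     = s≤s (s≤s z≤n)
... | _ , 2 , _    , refl , _     = ≤-refl
... | s , suc (suc (suc r)) , refl , _ , s+t≡n =
  contradiction rotation (¬rotation-by-eighth r s (trans (sym s+t≡n) (s+[3+r]≡r+[3+s] s r)) f f-automorphism)
  where
  s+[3+r]≡r+[3+s] : ∀ s r → s + (3 + r) ≡ r + (3 + s)
  s+[3+r]≡r+[3+s] = solve-∀

proposition3p1 : ∀ (n : ℕ) → 2 ≤ n → IsHamiltonCycle n (Γ n) × CompressionFactorIs n (Γ n) 4
proposition3p1 (suc (suc m)) (s≤s (s≤s z≤n)) =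
  (3≤length , Γ-unique (2 + m) , ∈-Γ , Γ-cyclic (suc m)) , Γ-4-symmetric m , Γ-symmetry≤4 (2 + m)
  where
  3≤length : 3 ≤ length (Γ (2 + m))
  3≤length = subst (3 ≤_) (sym (length-Γ (2 + m)))
    (≤-trans (n≤1+n 3) (*-monoʳ-≤ 2 (*-monoʳ-≤ 2 (m^n>0 2 m))))
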